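{- Let $a\le 0$ be an integer. Define $a_{\mathcal{M}}(n)$, $n\ge 0$, by $a_{\mathcal{M}}(0)=1$, $a_{\mathcal{M}}(1)=-1$, $a_{\mathcal{M}}(2)=a$ and, for $n\ge3$, $a_{\mathcal{M}}(n)=-\frac{1}{2}\sum_{k=0}^{n-1}a_{\mathcal{M}}(k)\binom{n}{k}2^{n-k}$. For integers $0\le j\le d$ set $$c_{\mathcal{M}}(j,d)=\sum_{k=j}^d2^{ -k}\binom{d-j}{d-k}a_{\mathcal{M}}(k).$$ Then for all $d\ge 0$ and $0\le j\le d$, $c_{\mathcal{M}}(j,d)=(-1)^dc_{\mathcal{M}}(d-j,d)$. -}

module Defs where

open import Data.Nat using (ℕ; zero; suc; _∸_; _+_)
open import Data.Nat.Combinatorics using (_C_)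
open import Data.Integer using (ℤ; +_)
open import Data.Rational using (ℚ; _/_; 0ℚ; 1ℚ; ½; -_; _*_) renaming (_+_ to _+ℚ_)
open import Data.List using (List; []; _∷_; _++_; map; foldr; zipWith; upTo)

ℕ→ℚ : ℕ → ℚ
ℕ→ℚ n = (+ n) / 1

ℤ→ℚ : ℤ → ℚ
ℤ→ℚ z = z / 1

_^ℚ_ : ℚ → ℕ → ℚ
q ^ℚ zero  = 1ℚ
q ^ℚ suc n = q * (q ^ℚ n)

sumℚ : List ℚ → ℚ
sumℚ = foldr _+ℚ_ 0ℚ

-- given the list [a(0), ..., a(n-1)], compute a(n)
step : ℤ → ℕ → List ℚ → ℚ
step a 0 xs = 1ℚ
step a 1 xs = - 1ℚ
step a 2 xs = ℤ→ℚ a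
step a n@(suc (suc (suc _))) xs =
  - (½ * sumℚ (zipWith (λ k ak → ak * ℕ→ℚ (n C k) * ((ℕ→ℚ 2) ^ℚ (n ∸ k))) (upTo n) xs))

prefix : ℤ → ℕ → List ℚ
prefix a zero    = []
prefix a (suc n) = prefix a n ++ (step a n (prefix a n) ∷ [])

aM : ℤ → ℕ → ℚ
aM a n = step a n (prefix a n)

-- c_M(j,d) = Σ_{k=j}^{d} 2^{-k} C(d-j, d-k) a_M(k); write k = j + i, 0 ≤ i ≤ d - j
cM : ℤ → ℕ → ℕ → ℚ
cM a j d = sumℚ (map (λ i → let k = j + i in (½ ^ℚ k) * ℕ→ℚ ((d ∸ j) C (d ∸ k)) * aM a k)
                     (upTo (suc (d ∸ j))))

-- Put b k = 2⁻ᵏ a(k) and B(j, m) = Σᵢ₌₀ᵐ C(m,i) b(j+i), so that c(j, d) = B(j, d − j).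
-- Both B(j, m) and its reflection (−1)ʲ⁺ᵐ B(m, j) obey Pascal's rule
-- X(j, m+1) = X(j, m) + X(j+1, m), hence so does their difference D.  A solution of
-- Pascal's rule with D(n, 0) = −D(0, n) vanishes: inductively D is constant along each
-- antidiagonal j + m = n, whose ends are then both D(0, n) and −D(0, n).  For b the
-- boundary condition is automatic when n is even, and for odd n it reads
-- B(0, n) = −b(n): for n ≥ 3 this is the defining recursion of a(n), for n = 1 it is
-- a(0) + a(1) = 0.
module Submission where

open import Data.Integer as ℤ using (ℤ) renaming (_≤_ to _≤ℤ_; 0ℤ to 0ℤ)
import Data.Integer.Properties as ℤ
open import Data.List using (_++_; _∷_; []; zipWith; applyUpTo; upTo)
open import Data.List.Properties using (map-applyUpTo; applyUpTo-∷ʳ)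
open import Data.Nat as ℕ using (ℕ; zero; suc; _∸_; _≤_; _<_; s≤s; z≤n)
import Data.Nat.Properties as ℕ
open import Data.Nat.Combinatorics
  using (_C_; nCn≡1; k>n⇒nCk≡0; nCk≡nC[n∸k]; nCk+nC[k+1]≡[n+1]C[k+1])
open import Data.Nat.Coprimality using (Coprime; 1-coprimeTo) renaming (sym to coprime-sym)
open import Data.Rational using (ℚ; mkℚ; 0ℚ; 1ℚ; ½; _+_; _*_; -_)
open import Data.Rational.Properties
  using (normalize-coprime; /-cong; +-identityˡ; +-assoc; *-assoc; *-distribʳ-+; +-0-group)
open import Algebra.Properties.Group +-0-group using (x∙y⁻¹≈ε⇒x≈y)
open import Data.Rational.Solver using (module +-*-Solver)
open import Function using (_∘_; id)
open import Relation.Binary.PropositionalEquality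
  using (_≡_; refl; sym; trans; cong; cong₂; module ≡-Reasoning)
open import Defs

open +-*-Solver
open ≡-Reasoning

ℕ→ℚ-suc : ∀ n → ℕ→ℚ (suc n) ≡ 1ℚ + ℕ→ℚ n
ℕ→ℚ-suc n = begin
  ℕ→ℚ (suc n)                    ≡⟨ /-cong {q₁ = 1} (cong (ℤ._+_ (ℤ.+ 1)) (ℤ.*-identityʳ (ℤ.+ n))) refl ⟨
  1ℚ + mkℚ (ℤ.+ n) 0 n-coprime-1  ≡⟨ cong (1ℚ +_) (normalize-coprime n-coprime-1) ⟨
  1ℚ + ℕ→ℚ n                     ∎
  where
  n-coprime-1 : Coprime n 1
  n-coprime-1 = coprime-sym (1-coprimeTo n)

ℕ→ℚ-+ : ∀ m n → ℕ→ℚ (m ℕ.+ n) ≡ ℕ→ℚ m + ℕ→ℚ n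
ℕ→ℚ-+ zero    n = sym (+-identityˡ (ℕ→ℚ n))
ℕ→ℚ-+ (suc m) n = begin
  ℕ→ℚ (suc (m ℕ.+ n))        ≡⟨ ℕ→ℚ-suc (m ℕ.+ n) ⟩
  1ℚ + ℕ→ℚ (m ℕ.+ n)         ≡⟨ cong (1ℚ +_) (ℕ→ℚ-+ m n) ⟩
  1ℚ + (ℕ→ℚ m + ℕ→ℚ n)       ≡⟨ +-assoc 1ℚ (ℕ→ℚ m) (ℕ→ℚ n) ⟨
  (1ℚ + ℕ→ℚ m) + ℕ→ℚ n       ≡⟨ cong (_+ ℕ→ℚ n) (ℕ→ℚ-suc m) ⟨
  ℕ→ℚ (suc m) + ℕ→ℚ n        ∎

^ℚ-+ : ∀ q m n → q ^ℚ (m ℕ.+ n) ≡ q ^ℚ m * q ^ℚ n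
^ℚ-+ q zero    n = solve 1 (λ x → x := con 1ℚ :* x) refl (q ^ℚ n)
^ℚ-+ q (suc m) n = trans (cong (q *_) (^ℚ-+ q m n))
  (solve 3 (λ q x y → q :* (x :* y) := (q :* x) :* y) refl q (q ^ℚ m) (q ^ℚ n))

½^n*2^n≡1 : ∀ n → ½ ^ℚ n * ℕ→ℚ 2 ^ℚ n ≡ 1ℚ
½^n*2^n≡1 zero    = refl
½^n*2^n≡1 (suc n) = trans
  (solve 2 (λ x y → (con ½ :* x) :* (con (ℕ→ℚ 2) :* y) := con (½ * ℕ→ℚ 2) :* (x :* y))
           refl (½ ^ℚ n) (ℕ→ℚ 2 ^ℚ n))
  (cong (½ * ℕ→ℚ 2 *_) (½^n*2^n≡1 n))

½^m≡½^n*2^[n∸m] : ∀ {m n} → m ≤ n → ½ ^ℚ m ≡ ½ ^ℚ n * ℕ→ℚ 2 ^ℚ (n ∸ m)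
½^m≡½^n*2^[n∸m] {m} {n} m≤n = begin
  ½ ^ℚ m                                  ≡⟨ solve 1 (λ x → x := x :* con 1ℚ) refl (½ ^ℚ m) ⟩
  ½ ^ℚ m * 1ℚ                             ≡⟨ cong (½ ^ℚ m *_) (½^n*2^n≡1 r) ⟨
  ½ ^ℚ m * (½ ^ℚ r * ℕ→ℚ 2 ^ℚ r)          ≡⟨ *-assoc (½ ^ℚ m) (½ ^ℚ r) (ℕ→ℚ 2 ^ℚ r) ⟨
  ½ ^ℚ m * ½ ^ℚ r * ℕ→ℚ 2 ^ℚ r            ≡⟨ cong (_* ℕ→ℚ 2 ^ℚ r) (^ℚ-+ ½ m r) ⟨
  ½ ^ℚ (m ℕ.+ r) * ℕ→ℚ 2 ^ℚ r             ≡⟨ cong (λ k → ½ ^ℚ k * ℕ→ℚ 2 ^ℚ r) (ℕ.m+[n∸m]≡n m≤n) ⟩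
  ½ ^ℚ n * ℕ→ℚ 2 ^ℚ r                     ∎
  where
  r : ℕ
  r = n ∸ m

p≡-p⇒p≡0 : ∀ {p} → p ≡ - p → p ≡ 0ℚ
p≡-p⇒p≡0 {p} p≡-p = begin
  p               ≡⟨ solve 1 (λ x → x := con ½ :* (x :+ x)) refl p ⟩
  ½ * (p + p)     ≡⟨ cong (λ q → ½ * (p + q)) p≡-p ⟩
  ½ * (p + - p)   ≡⟨ solve 1 (λ x → con ½ :* (x :- x) := con 0ℚ) refl p ⟩
  0ℚ              ∎

∑ : ℕ → (ℕ → ℚ) → ℚ
∑ zero    f = 0ℚ
∑ (suc n) f = f 0 + ∑ n (f ∘ suc)

∑-cong : ∀ n {f g : ℕ → ℚ} → (∀ i → i < n → f i ≡ g i) → ∑ n f ≡ ∑ n g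
∑-cong zero    f≗g = refl
∑-cong (suc n) f≗g = cong₂ _+_ (f≗g 0 (s≤s z≤n)) (∑-cong n (λ i i<n → f≗g (suc i) (s≤s i<n)))

∑-snoc : ∀ n f → ∑ (suc n) f ≡ ∑ n f + f n
∑-snoc zero    f = solve 1 (λ x → x :+ con 0ℚ := con 0ℚ :+ x) refl (f 0)
∑-snoc (suc n) f = trans (cong (f 0 +_) (∑-snoc n (f ∘ suc)))
  (solve 3 (λ x y z → x :+ (y :+ z) := (x :+ y) :+ z) refl (f 0) (∑ n (f ∘ suc)) (f (suc n)))

∑-distrib-+ : ∀ n f g → ∑ n (λ i → f i + g i) ≡ ∑ n f + ∑ n g
∑-distrib-+ zero    f g = refl
∑-distrib-+ (suc n) f g = trans (cong (f 0 + g 0 +_) (∑-distrib-+ n (f ∘ suc) (g ∘ suc)))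
  (solve 4 (λ a b x y → (a :+ b) :+ (x :+ y) := (a :+ x) :+ (b :+ y)) refl (f 0) (g 0) (∑ n (f ∘ suc)) (∑ n (g ∘ suc)))

*-distribˡ-∑ : ∀ n q f → ∑ n (λ i → q * f i) ≡ q * ∑ n f
*-distribˡ-∑ zero    q f = solve 1 (λ q → con 0ℚ := q :* con 0ℚ) refl q
*-distribˡ-∑ (suc n) q f = trans (cong (q * f 0 +_) (*-distribˡ-∑ n q (f ∘ suc)))
  (solve 3 (λ q a x → q :* a :+ q :* x := q :* (a :+ x)) refl q (f 0) (∑ n (f ∘ suc)))

sumℚ-applyUpTo : ∀ f n → sumℚ (applyUpTo f n) ≡ ∑ n f
sumℚ-applyUpTo f zero    = refl
sumℚ-applyUpTo f (suc n) = cong (f 0 +_) (sumℚ-applyUpTo (f ∘ suc) n)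

sumℚ-zipWith-applyUpTo : ∀ {A B : Set} (h : A → B → ℚ) (f : ℕ → A) (g : ℕ → B) n →
  sumℚ (zipWith h (applyUpTo f n) (applyUpTo g n)) ≡ ∑ n (λ i → h (f i) (g i))
sumℚ-zipWith-applyUpTo h f g zero    = refl
sumℚ-zipWith-applyUpTo h f g (suc n) =
  cong (h (f 0) (g 0) +_) (sumℚ-zipWith-applyUpTo h (f ∘ suc) (g ∘ suc) n)

module PascalVanishing (G : ℕ → ℕ → ℚ)
  (G-pascal : ∀ j m → G j (suc m) ≡ G j m + G (suc j) m)
  (G-antisym : ∀ n → G n 0 ≡ - G 0 n) where

  shift-along-antidiagonal : ∀ {j m} → G j m ≡ 0ℚ → G (suc j) m ≡ G j (suc m)
  shift-along-antidiagonal {j} {m} Gjm≡0 = begin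
    G (suc j) m            ≡⟨ +-identityˡ (G (suc j) m) ⟨
    0ℚ + G (suc j) m       ≡⟨ cong (_+ G (suc j) m) Gjm≡0 ⟨
    G j m + G (suc j) m    ≡⟨ G-pascal j m ⟨
    G j (suc m)            ∎

  constant-on-antidiagonal : ∀ n → (∀ j m → j ℕ.+ m ≡ n → G j m ≡ 0ℚ) →
                             ∀ j m → j ℕ.+ m ≡ suc n → G j m ≡ G 0 (suc n)
  constant-on-antidiagonal n _    zero    m refl = refl
  constant-on-antidiagonal n prev (suc j) m j+m≡n = trans
    (shift-along-antidiagonal (prev j m (ℕ.suc-injective j+m≡n)))
    (constant-on-antidiagonal n prev j (suc m) (trans (ℕ.+-suc j m) j+m≡n))

  vanishes-on-antidiagonal : ∀ n j m → j ℕ.+ m ≡ n → G j m ≡ 0ℚ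
  vanishes-on-antidiagonal zero    zero zero refl = p≡-p⇒p≡0 (G-antisym 0)
  vanishes-on-antidiagonal (suc n) j    m    j+m≡n = trans (constant j m j+m≡n) (p≡-p⇒p≡0 (begin
    G 0 (suc n)        ≡⟨ constant (suc n) 0 (ℕ.+-identityʳ (suc n)) ⟨
    G (suc n) 0        ≡⟨ G-antisym (suc n) ⟩
    - G 0 (suc n)      ∎))
    where
    constant : ∀ j m → j ℕ.+ m ≡ suc n → G j m ≡ G 0 (suc n)
    constant = constant-on-antidiagonal n (vanishes-on-antidiagonal n)

  pascal-vanishes : ∀ j m → G j m ≡ 0ℚ
  pascal-vanishes j m = vanishes-on-antidiagonal (j ℕ.+ m) j m refl

sign : ℕ → ℚ
sign n = (- 1ℚ) ^ℚ n

module BinomialSum (f : ℕ → ℚ) where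

  binomialSum : ℕ → ℕ → ℚ
  binomialSum j m = ∑ (suc m) (λ i → ℕ→ℚ (m C i) * f (j ℕ.+ i))

  binomialSum-pascal : ∀ j m → binomialSum j (suc m) ≡ binomialSum j m + binomialSum (suc j) m
  binomialSum-pascal j m = begin
    f₀ + ∑ (suc m) (λ i → ℕ→ℚ (suc m C suc i) * f (j ℕ.+ suc i))
      ≡⟨ cong (f₀ +_) (∑-cong (suc m) (λ i _ → pascal-term i)) ⟩
    f₀ + ∑ (suc m) (λ i → g i + h i)
      ≡⟨ cong (f₀ +_) (∑-distrib-+ (suc m) g h) ⟩
    f₀ + (∑ (suc m) g + ∑ (suc m) h)
      ≡⟨ cong (λ x → f₀ + (∑ (suc m) g + x)) (∑-snoc m h) ⟩
    f₀ + (∑ (suc m) g + (∑ m h + ℕ→ℚ (m C suc m) * f (j ℕ.+ suc m)))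
      ≡⟨ cong (λ c → f₀ + (∑ (suc m) g + (∑ m h + ℕ→ℚ c * f (j ℕ.+ suc m)))) (k>n⇒nCk≡0 (ℕ.n<1+n m)) ⟩
    f₀ + (∑ (suc m) g + (∑ m h + 0ℚ * f (j ℕ.+ suc m)))
      ≡⟨ solve 4 (λ p x y w → p :+ (x :+ (y :+ con 0ℚ :* w)) := (p :+ y) :+ x)
                 refl f₀ (∑ (suc m) g) (∑ m h) (f (j ℕ.+ suc m)) ⟩
    (f₀ + ∑ m h) + ∑ (suc m) g ∎
    where
    f₀ : ℚ
    f₀ = 1ℚ * f (j ℕ.+ 0)
    g h : ℕ → ℚ
    g i = ℕ→ℚ (m C i) * f (suc j ℕ.+ i)
    h i = ℕ→ℚ (m C suc i) * f (j ℕ.+ suc i)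
    pascal-term : ∀ i → ℕ→ℚ (suc m C suc i) * f (j ℕ.+ suc i) ≡ g i + h i
    pascal-term i = begin
      ℕ→ℚ (suc m C suc i) * f (j ℕ.+ suc i)
        ≡⟨ cong (λ c → ℕ→ℚ c * f (j ℕ.+ suc i)) (nCk+nC[k+1]≡[n+1]C[k+1] m i) ⟨
      ℕ→ℚ (m C i ℕ.+ m C suc i) * f (j ℕ.+ suc i)
        ≡⟨ cong (_* f (j ℕ.+ suc i)) (ℕ→ℚ-+ (m C i) (m C suc i)) ⟩
      (ℕ→ℚ (m C i) + ℕ→ℚ (m C suc i)) * f (j ℕ.+ suc i)
        ≡⟨ *-distribʳ-+ (f (j ℕ.+ suc i)) (ℕ→ℚ (m C i)) (ℕ→ℚ (m C suc i)) ⟩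
      ℕ→ℚ (m C i) * f (j ℕ.+ suc i) + h i
        ≡⟨ cong (λ k → ℕ→ℚ (m C i) * f k + h i) (ℕ.+-suc j i) ⟩
      g i + h i ∎

  reflectionDefect : ℕ → ℕ → ℚ
  reflectionDefect j m = binomialSum j m + - (sign (j ℕ.+ m) * binomialSum m j)

  reflectionDefect-pascal : ∀ j m →
    reflectionDefect j (suc m) ≡ reflectionDefect j m + reflectionDefect (suc j) m
  reflectionDefect-pascal j m = begin
    binomialSum j (suc m) + - (sign (j ℕ.+ suc m) * binomialSum (suc m) j)
      ≡⟨ cong₂ (λ x k → x + - (sign k * binomialSum (suc m) j)) (binomialSum-pascal j m) (ℕ.+-suc j m) ⟩
    (P + Q) + - ((- 1ℚ * s) * T)
      ≡⟨ solve 5 (λ P Q R T s → (P :+ Q) :- ((con (- 1ℚ) :* s) :* T)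
                              := (P :- s :* R) :+ (Q :- (con (- 1ℚ) :* s) :* (R :+ T))) refl P Q R T s ⟩
    (P + - (s * R)) + (Q + - ((- 1ℚ * s) * (R + T)))
      ≡⟨ cong (λ x → (P + - (s * R)) + (Q + - ((- 1ℚ * s) * x))) (binomialSum-pascal m j) ⟨
    reflectionDefect j m + reflectionDefect (suc j) m ∎
    where
    P Q R T s : ℚ
    P = binomialSum j m
    Q = binomialSum (suc j) m
    R = binomialSum m j
    T = binomialSum (suc m) j
    s = sign (j ℕ.+ m)

  sign≡1⇒reflectionDefect-antisym : ∀ n → sign n ≡ 1ℚ →
                                    reflectionDefect n 0 ≡ - reflectionDefect 0 n
  sign≡1⇒reflectionDefect-antisym n sign≡1 = begin
    binomialSum n 0 + - (sign (n ℕ.+ 0) * binomialSum 0 n)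
      ≡⟨ cong (λ s → binomialSum n 0 + - (s * binomialSum 0 n)) (trans (cong sign (ℕ.+-identityʳ n)) sign≡1) ⟩
    binomialSum n 0 + - (1ℚ * binomialSum 0 n)
      ≡⟨ solve 2 (λ x y → x :- con 1ℚ :* y := :- (y :- con 1ℚ :* x)) refl (binomialSum n 0) (binomialSum 0 n) ⟩
    - (binomialSum 0 n + - (1ℚ * binomialSum n 0))
      ≡⟨ cong (λ s → - (binomialSum 0 n + - (s * binomialSum n 0))) sign≡1 ⟨
    - reflectionDefect 0 n ∎

  binomialSum≡-f⇒reflectionDefect-antisym : ∀ n → binomialSum 0 n ≡ - f n →
                                            reflectionDefect n 0 ≡ - reflectionDefect 0 n
  binomialSum≡-f⇒reflectionDefect-antisym n B≡-f = begin
    binomialSum n 0 + - (sign (n ℕ.+ 0) * binomialSum 0 n)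
      ≡⟨ cong₂ (λ x k → x + - (sign k * binomialSum 0 n)) binomialSum-n-0 (ℕ.+-identityʳ n) ⟩
    f n + - (sign n * binomialSum 0 n)
      ≡⟨ cong (λ x → f n + - (sign n * x)) B≡-f ⟩
    f n + - (sign n * - f n)
      ≡⟨ solve 2 (λ x s → x :- s :* (:- x) := :- ((:- x) :- s :* x)) refl (f n) (sign n) ⟩
    - (- f n + - (sign n * f n))
      ≡⟨ cong₂ (λ x y → - (x + - (sign n * y))) B≡-f binomialSum-n-0 ⟨
    - reflectionDefect 0 n ∎
    where
    binomialSum-n-0 : binomialSum n 0 ≡ f n
    binomialSum-n-0 = trans (cong (λ k → 1ℚ * f k + 0ℚ) (ℕ.+-identityʳ n))
                            (solve 1 (λ x → con 1ℚ :* x :+ con 0ℚ := x) refl (f n))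

  binomialSum-reflection : (∀ n → reflectionDefect n 0 ≡ - reflectionDefect 0 n) →
    ∀ j m → binomialSum j m ≡ sign (j ℕ.+ m) * binomialSum m j
  binomialSum-reflection antisym j m =
    x∙y⁻¹≈ε⇒x≈y _ _ (PascalVanishing.pascal-vanishes reflectionDefect reflectionDefect-pascal antisym j m)

prefix≡applyUpTo-aM : ∀ a n → prefix a n ≡ applyUpTo (aM a) n
prefix≡applyUpTo-aM a zero    = refl
prefix≡applyUpTo-aM a (suc n) = trans (cong (_++ aM a n ∷ []) (prefix≡applyUpTo-aM a n)) (applyUpTo-∷ʳ (aM a) n)

aM-recursion : ∀ a n → 3 ≤ n →
  aM a n ≡ - (½ * ∑ n (λ k → aM a k * ℕ→ℚ (n C k) * ℕ→ℚ 2 ^ℚ (n ∸ k)))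
aM-recursion a n (s≤s (s≤s (s≤s _))) = cong (λ x → - (½ * x)) (begin
  sumℚ (zipWith term (upTo n) (prefix a n))           ≡⟨ cong (sumℚ ∘ zipWith term (upTo n)) (prefix≡applyUpTo-aM a n) ⟩
  sumℚ (zipWith term (upTo n) (applyUpTo (aM a) n))   ≡⟨ sumℚ-zipWith-applyUpTo term id (aM a) n ⟩
  ∑ n (λ k → term k (aM a k))                          ∎)
  where
  term : ℕ → ℚ → ℚ
  term k ak = ak * ℕ→ℚ (n C k) * ℕ→ℚ 2 ^ℚ (n ∸ k)

scaled : (ℕ → ℚ) → ℕ → ℚ
scaled f k = ½ ^ℚ k * f k

module ScaledAM (a : ℤ) where
  open BinomialSum (scaled (aM a)) public

  binomialSum-recursion : ∀ n → 3 ≤ n → binomialSum 0 n ≡ - scaled (aM a) n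
  binomialSum-recursion n 3≤n = begin
    binomialSum 0 n
      ≡⟨ ∑-snoc n (λ k → ℕ→ℚ (n C k) * scaled (aM a) k) ⟩
    ∑ n (λ k → ℕ→ℚ (n C k) * scaled (aM a) k) + ℕ→ℚ (n C n) * scaled (aM a) n
      ≡⟨ cong₂ (λ x c → x + ℕ→ℚ c * scaled (aM a) n) (∑-cong n rescale) (nCn≡1 n) ⟩
    ∑ n (λ k → ½ⁿ * t k) + 1ℚ * (½ⁿ * aM a n)
      ≡⟨ cong₂ (λ x y → x + 1ℚ * (½ⁿ * y)) (*-distribˡ-∑ n ½ⁿ t) (aM-recursion a n 3≤n) ⟩
    ½ⁿ * ∑ n t + 1ℚ * (½ⁿ * - (½ * ∑ n t))
      ≡⟨ solve 2 (λ u T → u :* T :+ con 1ℚ :* (u :* (:- (con ½ :* T))) := :- (u :* (:- (con ½ :* T)))) refl ½ⁿ (∑ n t) ⟩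
    - (½ⁿ * - (½ * ∑ n t))
      ≡⟨ cong (λ y → - (½ⁿ * y)) (aM-recursion a n 3≤n) ⟨
    - scaled (aM a) n ∎
    where
    ½ⁿ : ℚ
    ½ⁿ = ½ ^ℚ n
    t : ℕ → ℚ
    t k = aM a k * ℕ→ℚ (n C k) * ℕ→ℚ 2 ^ℚ (n ∸ k)
    rescale : ∀ k → k < n → ℕ→ℚ (n C k) * scaled (aM a) k ≡ ½ⁿ * t k
    rescale k k<n = begin
      ℕ→ℚ (n C k) * (½ ^ℚ k * aM a k)
        ≡⟨ cong (λ x → ℕ→ℚ (n C k) * (x * aM a k)) (½^m≡½^n*2^[n∸m] (ℕ.<⇒≤ k<n)) ⟩
      ℕ→ℚ (n C k) * ((½ⁿ * ℕ→ℚ 2 ^ℚ (n ∸ k)) * aM a k)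
        ≡⟨ solve 4 (λ c u p x → c :* ((u :* p) :* x) := u :* (x :* c :* p))
                   refl (ℕ→ℚ (n C k)) ½ⁿ (ℕ→ℚ 2 ^ℚ (n ∸ k)) (aM a k) ⟩
      ½ⁿ * t k ∎

  reflectionDefect-antisym : ∀ n → reflectionDefect n 0 ≡ - reflectionDefect 0 n
  reflectionDefect-antisym 0                     = sign≡1⇒reflectionDefect-antisym 0 refl
  reflectionDefect-antisym 1                     = binomialSum≡-f⇒reflectionDefect-antisym 1 refl
  reflectionDefect-antisym 2                     = sign≡1⇒reflectionDefect-antisym 2 refl
  reflectionDefect-antisym n@(suc (suc (suc _))) =
    binomialSum≡-f⇒reflectionDefect-antisym n (binomialSum-recursion n (s≤s (s≤s (s≤s z≤n))))

  cM≡binomialSum : ∀ j d → cM a j d ≡ binomialSum j (d ∸ j)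
  cM≡binomialSum j d = trans
    (cong sumℚ (map-applyUpTo id term (suc (d ∸ j))))
    (trans (sumℚ-applyUpTo term (suc (d ∸ j))) (∑-cong (suc (d ∸ j)) reindex))
    where
    term : ℕ → ℚ
    term i = ½ ^ℚ (j ℕ.+ i) * ℕ→ℚ ((d ∸ j) C (d ∸ (j ℕ.+ i))) * aM a (j ℕ.+ i)
    reindex : ∀ i → i < suc (d ∸ j) → term i ≡ ℕ→ℚ ((d ∸ j) C i) * scaled (aM a) (j ℕ.+ i)
    reindex i (s≤s i≤d∸j) = begin
      ½ ^ℚ (j ℕ.+ i) * ℕ→ℚ ((d ∸ j) C (d ∸ (j ℕ.+ i))) * aM a (j ℕ.+ i)
        ≡⟨ cong (λ c → ½ ^ℚ (j ℕ.+ i) * ℕ→ℚ c * aM a (j ℕ.+ i))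
                (trans (nCk≡nC[n∸k] i≤d∸j) (cong ((d ∸ j) C_) (ℕ.∸-+-assoc d j i))) ⟨
      ½ ^ℚ (j ℕ.+ i) * ℕ→ℚ ((d ∸ j) C i) * aM a (j ℕ.+ i)
        ≡⟨ solve 3 (λ h c x → h :* c :* x := c :* (h :* x))
                   refl (½ ^ℚ (j ℕ.+ i)) (ℕ→ℚ ((d ∸ j) C i)) (aM a (j ℕ.+ i)) ⟩
      ℕ→ℚ ((d ∸ j) C i) * scaled (aM a) (j ℕ.+ i) ∎

mainTheorem9 : (a : ℤ) → a ≤ℤ 0ℤ → (d j : ℕ) → j ≤ d →
    cM a j d ≡ ((- 1ℚ) ^ℚ d) * cM a (d ∸ j) d
mainTheorem9 a _ d j j≤d = begin
  cM a j d                                  ≡⟨ cM≡binomialSum j d ⟩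
  binomialSum j m                           ≡⟨ binomialSum-reflection reflectionDefect-antisym j m ⟩
  sign (j ℕ.+ m) * binomialSum m j
    ≡⟨ cong₂ (λ k i → sign k * binomialSum m i) (ℕ.m+[n∸m]≡n j≤d) (sym (ℕ.m∸[m∸n]≡n j≤d)) ⟩
  sign d * binomialSum m (d ∸ m)            ≡⟨ cong (sign d *_) (cM≡binomialSum m d) ⟨
  sign d * cM a m d                         ∎
  where
  open ScaledAM a
  m : ℕ
  m = d ∸ j
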